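{- Let $a\in\{p_1,\dotsc,p_n\}$ and let $x$ be a feasible solution of mod-IP($a$), and assume $B\neq\emptyset$. Run the procedure described in the context starting from $x$. Let $z$ be the current assignment at any moment during Phase II. Then there is a big machine $i\in B$ with $\sum_{j} p_j z_{ij}\le T_i-p_{\max}^2$. In particular, adding the jobs of any bundle to machine $i$ does not make its load exceed $T_i$.
   Context: A Multiway Partitioning instance consists of integers $n\ge m\ge1$, $p_1,\dotsc,p_n\in\mathbb{N}$ and $T_1,\dotsc,T_m\in\mathbb{N}$ with $p_1+\cdots+p_n=T_1+\cdots+T_m$ (jobs $j$ with processing times $p_j$, machines $i$ with targets $T_i$). Let $p_{\max}=\max_j p_j$ and $d=|\{p_1,\dotsc,p_n\}|$. A machine $i$ is small if $T_i<p_{\max}^4$ and big otherwise; $S$ is the set of small machines and $B=\{1,\dotsc,m\}\setminus S$. For $a\in\{p_1,\dotsc,p_n\}$, mod-IP($a$) is the system in binary variables $x_{ij}\in\{0,1\}$ ($i=1,\dotsc,m$, $j=1,\dotsc,n$): $\sum_j p_jx_{ij}=T_i$ for all $i\in S$; $\sum_j p_jx_{ij}\equiv T_i \pmod a$ for all $i\in B$; $\sum_{j:p_j=a}\sum_{i\in B}x_{ij}\ge p_{\max}^2|B|$; $\sum_{i=1}^m x_{ij}=1$ for all $j$. A 0/1 assignment $z$ (each job assigned to at most one machine) gives machine $i$ load $\sum_j p_jz_{ij}$. The procedure: Phase I: starting from the assignment $x$, remove (make unassigned) every job of processing time $a$ assigned to a big machine; then, as long as there are a big machine $i$ and a value $b\neq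 a$ such that at least $a$ jobs of processing time $b$ are assigned to $i$, remove $a$ of these jobs from $i$ together; such a removed group of $a$ jobs is called a bundle. Phase II: the bundles are reassigned one at a time, each bundle's jobs all to a single big machine $i$ whose load after adding the bundle does not exceed $T_i$. Phase III: then the removed jobs of processing time $a$ are reassigned one at a time, each to a big machine $i$ whose load after adding it does not exceed $T_i$. -}

module Defs where

open import Data.Nat using (ℕ; zero; suc; _+_; _*_; _^_; _≤_; _<_; _⊔_; _≡ᵇ_; ∣_-_∣)
open import Data.Nat.Properties using (_≤?_)
open import Data.Nat.Divisibility using (_∣_)
open import Data.Bool using (Bool; true; false; if_then_else_; _∧_)
open import Data.Fin using (Fin; zero; suc; _≟_)
open import Data.Fin.Subset using (Subset; _∈_; ∣_∣)
open import Data.Vec using (lookup)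
open import Data.List using (List; []; _∷_; _++_)
open import Data.Product using (_×_; _,_; Σ; ∃)
open import Relation.Nullary using (does; ¬_)
open import Relation.Binary.PropositionalEquality using (_≡_; _≢_)
open import Relation.Binary.Construct.Closure.ReflexiveTransitive using (Star)
open import Function using (_∘_)

∑ : ∀ {k} → (Fin k → ℕ) → ℕ
∑ {zero} f = 0
∑ {suc k} f = f zero + ∑ (f ∘ suc)

maxᶠ : ∀ {k} → (Fin k → ℕ) → ℕ
maxᶠ {zero} f = 0
maxᶠ {suc k} f = f zero ⊔ maxᶠ (f ∘ suc)

-- An instance: jobs Fin n with processing times p, machines Fin m with targets T,
-- and the chosen value a.
module Procedure {n m : ℕ} (p : Fin n → ℕ) (T : Fin m → ℕ) (a : ℕ) where

  pmax : ℕ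
  pmax = maxᶠ p

  IsSmall : Fin m → Set
  IsSmall i = T i < pmax ^ 4

  IsBig : Fin m → Set
  IsBig i = pmax ^ 4 ≤ T i

  big? : Fin m → Bool
  big? i = does (pmax ^ 4 ≤? T i)

  numBig : ℕ
  numBig = ∑ (λ i → if big? i then 1 else 0)

  -- (partial) assignments as 0/1 matrices z i j
  Assignment : Set
  Assignment = Fin m → Fin n → ℕ

  load : Assignment → Fin m → ℕ
  load z i = ∑ (λ j → p j * z i j)

  ModIPFeasible : Assignment → Set
  ModIPFeasible x =
    (∀ i j → x i j ≤ 1) ×
    (∀ i → IsSmall i → load x i ≡ T i) ×
    (∀ i → IsBig i → a ∣ ∣ load x i - T i ∣) ×
    (pmax ^ 2 * numBig ≤ ∑ (λ j → if p j ≡ᵇ a then ∑ (λ i → if big? i then x i j else 0) else 0)) ×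
    (∀ j → ∑ (λ i → x i j) ≡ 1)

  -- Phase I, first part: unassign every job of processing time a on a big machine
  removeA : Assignment → Assignment
  removeA x i j = if big? i ∧ (p j ≡ᵇ a) then 0 else x i j

  countOn : Assignment → Fin m → ℕ → ℕ
  countOn z i b = ∑ (λ j → if p j ≡ᵇ b then z i j else 0)

  removeBundle : Assignment → Fin m → Subset n → Assignment
  removeBundle z i β i' j = if does (i' ≟ i) ∧ lookup β j then 0 else z i' j

  addBundle : Assignment → Fin m → Subset n → Assignment
  addBundle z i β i' j = if does (i' ≟ i) ∧ lookup β j then 1 else z i' j

  -- state: current assignment and list of bundles formed so far
  State : Set
  State = Assignment × List (Subset n)

  data BundleStep : State → State → Set where
    remove : ∀ {z bs} (i : Fin m) (b : ℕ) (β : Subset n) →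
             IsBig i → b ≢ a → ∣ β ∣ ≡ a →
             (∀ j → j ∈ β → (z i j ≡ 1 × p j ≡ b)) →
             BundleStep (z , bs) (removeBundle z i β , β ∷ bs)

  PhaseIEnd : State → Set
  PhaseIEnd (z , bs) = ∀ i b → IsBig i → b ≢ a → countOn z i b < a

  PhaseIResult : Assignment → State → Set
  PhaseIResult x s = Star BundleStep (removeA x , []) s × PhaseIEnd s

  -- one step of Phase II: some remaining bundle is put on a big machine that
  -- does not exceed its target afterwards; state = (assignment, remaining bundles)
  data PlaceStep : State → State → Set where
    place : ∀ {z} (pre post : List (Subset n)) (β : Subset n) (i : Fin m) →
            IsBig i → load (addBundle z i β) i ≤ T i →
            PlaceStep (z , pre ++ β ∷ post) (addBundle z i β , pre ++ post)

-- Track the potential "load on the big machines + weight of the pending bundles".  Feasibility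
-- of mod-IP(a) fills every small machine exactly, so the big machines start exactly at their
-- total target, and unassigning their (at least pmax²·|B|) jobs of time a ≥ 1 leaves slack
-- pmax²·|B|.  Forming a bundle moves its weight from a machine to the pending bundles and placing
-- it moves the weight back, so the potential never increases and the slack survives.  Averaging
-- over B gives a big machine with room pmax², and a bundle of a jobs of time ≤ pmax, a ≤ pmax,
-- weighs at most pmax².
module Submission where

open import Defs
open import Data.Nat hiding (_≟_)
open import Data.Nat.Properties hiding (_≟_; suc-injective)
open import Algebra.Properties.CommutativeSemigroup +-commutativeSemigroup
  using (interchange; xy∙z≈xz∙y; x∙yz≈y∙xz)
open import Data.Bool using (true; false; if_then_else_)
open import Data.Fin using (Fin; zero; suc; _≟_)
open import Data.Fin.Properties using (suc-injective)
open import Data.Fin.Subset using (Subset; ∣_∣) renaming (_∈_ to _∈ₛ_)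
open import Data.Vec using ([]; _∷_; lookup)
open import Data.Vec.Properties using (lookup⇒[]=)
open import Data.List using (List; []; _∷_; _++_)
open import Data.List.Membership.Propositional using (_∈_)
open import Data.List.Relation.Unary.All as All using (All; []; _∷_)
open import Data.List.Relation.Unary.All.Properties using (++⁺; ++⁻)
open import Data.Product as Product using (_×_; _,_; ∃; proj₁)
open import Data.Empty using (⊥-elim)
open import Function using (_∘_; _∘₂_; id)
open import Relation.Binary.PropositionalEquality
open import Relation.Binary.Construct.Closure.ReflexiveTransitive using (Star; fold)
open import Relation.Nullary using (yes; no; ¬_; proof)
open import Relation.Nullary.Reflects using (Reflects; ofⁿ)
open import Relation.Nullary.Decidable using (dec-true; dec-false)

∑-cong : ∀ {k} {f g : Fin k → ℕ} → (∀ i → f i ≡ g i) → ∑ f ≡ ∑ g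
∑-cong {zero}  _   = refl
∑-cong {suc k} f≗g = cong₂ _+_ (f≗g zero) (∑-cong (f≗g ∘ suc))

∑-mono-≤ : ∀ {k} {f g : Fin k → ℕ} → (∀ i → f i ≤ g i) → ∑ f ≤ ∑ g
∑-mono-≤ {zero}  _   = z≤n
∑-mono-≤ {suc k} f≤g = +-mono-≤ (f≤g zero) (∑-mono-≤ (f≤g ∘ suc))

∑-zero : ∀ k → ∑ {k} (λ _ → 0) ≡ 0
∑-zero zero    = refl
∑-zero (suc k) = ∑-zero k

∑-distrib-+ : ∀ {k} (f g : Fin k → ℕ) → ∑ (λ i → f i + g i) ≡ ∑ f + ∑ g
∑-distrib-+ {zero}  f g = refl
∑-distrib-+ {suc k} f g =
  trans (cong (f zero + g zero +_) (∑-distrib-+ (f ∘ suc) (g ∘ suc)))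
        (interchange (f zero) (g zero) (∑ (f ∘ suc)) (∑ (g ∘ suc)))

*-distribˡ-∑ : ∀ {k} c (f : Fin k → ℕ) → c * ∑ f ≡ ∑ (λ i → c * f i)
*-distribˡ-∑ {zero}  c f = *-zeroʳ c
*-distribˡ-∑ {suc k} c f =
  trans (*-distribˡ-+ c (f zero) (∑ (f ∘ suc))) (cong (c * f zero +_) (*-distribˡ-∑ c (f ∘ suc)))

∑-comm : ∀ {k l} (f : Fin k → Fin l → ℕ) → ∑ (λ i → ∑ (f i)) ≡ ∑ (λ j → ∑ (λ i → f i j))
∑-comm {zero}  {l} f = sym (∑-zero l)
∑-comm {suc k}     f =
  trans (cong (∑ (f zero) +_) (∑-comm (f ∘ suc))) (sym (∑-distrib-+ (f zero) _))

≤-∑ : ∀ {k} (f : Fin k → ℕ) i → f i ≤ ∑ f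
≤-∑ f zero    = m≤m+n (f zero) _
≤-∑ f (suc i) = ≤-trans (≤-∑ (f ∘ suc) i) (m≤n+m _ (f zero))

∑-<⇒∃-< : ∀ {k} {f g : Fin k → ℕ} → ∑ f < ∑ g → ∃ λ i → f i < g i
∑-<⇒∃-< {zero} ()
∑-<⇒∃-< {suc k} {f} {g} ∑f<∑g with f zero <? g zero
... | yes f₀<g₀ = zero , f₀<g₀
... | no  f₀≮g₀ = Product.map suc id (∑-<⇒∃-< (≰⇒> λ tail≥ →
                    <⇒≱ ∑f<∑g (+-mono-≤ (≮⇒≥ f₀≮g₀) tail≥)))

∑-update-≤ : ∀ {k} {f g : Fin k → ℕ} i {d e} →
             (∀ j → j ≢ i → f j ≡ g j) → f i + d ≤ g i + e → ∑ f + d ≤ ∑ g + e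
∑-update-≤ {suc k} {f} {g} zero {d} {e} agree fᵢ+d≤gᵢ+e = begin
  f zero + ∑ (f ∘ suc) + d  ≡⟨ xy∙z≈xz∙y (f zero) _ d ⟩
  f zero + d + ∑ (f ∘ suc)  ≤⟨ +-mono-≤ fᵢ+d≤gᵢ+e (≤-reflexive tail≡) ⟩
  g zero + e + ∑ (g ∘ suc)  ≡⟨ xy∙z≈xz∙y (g zero) _ e ⟨
  g zero + ∑ (g ∘ suc) + e  ∎
  where
  open ≤-Reasoning
  tail≡ : ∑ (f ∘ suc) ≡ ∑ (g ∘ suc)
  tail≡ = ∑-cong λ j → agree (suc j) λ ()
∑-update-≤ {suc k} {f} {g} (suc i) {d} {e} agree fᵢ+d≤gᵢ+e = begin
  f zero + ∑ (f ∘ suc) + d    ≡⟨ +-assoc (f zero) _ d ⟩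
  f zero + (∑ (f ∘ suc) + d)  ≤⟨ +-mono-≤ (≤-reflexive (agree zero λ ())) tail≤ ⟩
  g zero + (∑ (g ∘ suc) + e)  ≡⟨ +-assoc (g zero) _ e ⟨
  g zero + ∑ (g ∘ suc) + e    ∎
  where
  open ≤-Reasoning
  tail≤ : ∑ (f ∘ suc) + d ≤ ∑ (g ∘ suc) + e
  tail≤ = ∑-update-≤ i (λ j j≢i → agree (suc j) (j≢i ∘ suc-injective)) fᵢ+d≤gᵢ+e

if-split : ∀ b x → x ≡ (if b then x else 0) + (if b then 0 else x)
if-split true  x = sym (+-identityʳ x)
if-split false x = refl

if-distrib-+ : ∀ b x y → (if b then x + y else 0) ≡ (if b then x else 0) + (if b then y else 0)
if-distrib-+ true  x y = refl
if-distrib-+ false x y = refl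

*-distribˡ-if : ∀ c b x → c * (if b then x else 0) ≡ (if b then c * x else 0)
*-distribˡ-if c true  x = refl
*-distribˡ-if c false x = *-zeroʳ c

if-comm : ∀ b b′ x → (if b then (if b′ then x else 0) else 0) ≡ (if b′ then (if b then x else 0) else 0)
if-comm true  b′    x = refl
if-comm false true  x = refl
if-comm false false x = refl

if-∑ : ∀ {k} b (f : Fin k → ℕ) → (if b then ∑ f else 0) ≡ ∑ (λ i → if b then f i else 0)
if-∑     true  f = refl
if-∑ {k} false f = sym (∑-zero k)

∑-selected-const : ∀ {k} (β : Subset k) c → ∑ (λ j → if lookup β j then c else 0) ≡ ∣ β ∣ * c
∑-selected-const []          c = refl
∑-selected-const (true  ∷ β) c = cong (c +_) (∑-selected-const β c)
∑-selected-const (false ∷ β) c = ∑-selected-const β c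

≤-maxᶠ : ∀ {k} (f : Fin k → ℕ) i → f i ≤ maxᶠ f
≤-maxᶠ f zero    = m≤m⊔n (f zero) _
≤-maxᶠ f (suc i) = ≤-trans (≤-maxᶠ (f ∘ suc) i) (m≤n⊔m (f zero) _)

∑-selected-≤ : ∀ {k} (β : Subset k) (f : Fin k → ℕ) →
               ∑ (λ j → if lookup β j then f j else 0) ≤ ∣ β ∣ * maxᶠ f
∑-selected-≤ β f = ≤-trans (∑-mono-≤ selected≤max) (≤-reflexive (∑-selected-const β (maxᶠ f)))
  where
  selected≤max : ∀ j → (if lookup β j then f j else 0) ≤ (if lookup β j then maxᶠ f else 0)
  selected≤max j with lookup β j
  ... | true  = ≤-maxᶠ f j
  ... | false = z≤n

module _ {S : Set} {_⟶_ : S → S → Set} where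

  Star-preserves : {P : S → Set} → (∀ {s s′} → s ⟶ s′ → P s → P s′) →
                   ∀ {s s′} → Star _⟶_ s s′ → P s → P s′
  Star-preserves {P} preserves = fold (λ s s′ → P s → P s′) (λ step k → k ∘ preserves step) id

  Star-antitone : (Φ : S → ℕ) → (∀ {s s′} → s ⟶ s′ → Φ s′ ≤ Φ s) →
                  ∀ {s s′} → Star _⟶_ s s′ → Φ s′ ≤ Φ s
  Star-antitone Φ decreases {s} steps =
    Star-preserves {P = λ s′ → Φ s′ ≤ Φ s} (λ step → ≤-trans (decreases step)) steps ≤-refl

module PotentialBound {n m : ℕ} (p : Fin n → ℕ) (T : Fin m → ℕ) (a : ℕ) where
  open Procedure p T a

  big?-reflects : ∀ i → Reflects (IsBig i) (big? i)
  big?-reflects i = proof (pmax ^ 4 ≤? T i)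

  big?-true : ∀ {i} → IsBig i → big? i ≡ true
  big?-true {i} = dec-true (pmax ^ 4 ≤? T i)

  onBig onSmall : (Fin m → ℕ) → Fin m → ℕ
  onBig   f i = if big? i then f i else 0
  onSmall f i = if big? i then 0 else f i

  onBig-big : ∀ f {i} → IsBig i → onBig f i ≡ f i
  onBig-big f big rewrite big?-true big = refl

  onBig-small : ∀ f {i} → ¬ IsBig i → onBig f i ≡ 0
  onBig-small f {i} ¬big rewrite dec-false (pmax ^ 4 ≤? T i) ¬big = refl

  ∑-onBig-onSmall : ∀ f → ∑ f ≡ ∑ (onBig f) + ∑ (onSmall f)
  ∑-onBig-onSmall f = trans (∑-cong λ i → if-split (big? i) (f i)) (∑-distrib-+ (onBig f) (onSmall f))

  bigLoad : Assignment → ℕ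
  bigLoad z = ∑ (onBig (load z))

  bigTarget : ℕ
  bigTarget = ∑ (onBig T)

  weight : Subset n → ℕ
  weight β = ∑ (λ j → if lookup β j then p j else 0)

  totalWeight : List (Subset n) → ℕ
  totalWeight []      = 0
  totalWeight (β ∷ R) = weight β + totalWeight R

  totalWeight-middle : ∀ pre β post →
                       totalWeight (pre ++ β ∷ post) ≡ weight β + totalWeight (pre ++ post)
  totalWeight-middle []        β post = refl
  totalWeight-middle (γ ∷ pre) β post =
    trans (cong (weight γ +_) (totalWeight-middle pre β post)) (x∙yz≈y∙xz (weight γ) (weight β) _)

  potential : State → ℕ
  potential (z , R) = bigLoad z + totalWeight R

  BundlesOfSize : State → Set
  BundlesOfSize (_ , R) = All (λ β → ∣ β ∣ ≡ a) R

  load-removeBundle : ∀ z i β → (∀ j → j ∈ₛ β → z i j ≡ 1) →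
                      load (removeBundle z i β) i + weight β ≡ load z i
  load-removeBundle z i β β⊆row =
    trans (sym (∑-distrib-+ (λ j → p j * removeBundle z i β i j) selected)) (∑-cong entry)
    where
    selected : Fin n → ℕ
    selected j = if lookup β j then p j else 0
    entry : ∀ j → p j * removeBundle z i β i j + selected j ≡ p j * z i j
    entry j rewrite dec-true (i ≟ i) refl with lookup β j in β∋j
    ... | true  rewrite β⊆row j (lookup⇒[]= j β β∋j) =
      trans (cong (_+ p j) (*-zeroʳ (p j))) (sym (*-identityʳ (p j)))
    ... | false = +-identityʳ _

  load-addBundle : ∀ z i β → load (addBundle z i β) i ≤ load z i + weight β
  load-addBundle z i β = ≤-trans (∑-mono-≤ entry) (≤-reflexive (∑-distrib-+ (λ j → p j * z i j) selected))
    where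
    selected : Fin n → ℕ
    selected j = if lookup β j then p j else 0
    entry : ∀ j → p j * addBundle z i β i j ≤ p j * z i j + selected j
    entry j rewrite dec-true (i ≟ i) refl with lookup β j
    ... | true  = ≤-trans (≤-reflexive (*-identityʳ (p j))) (m≤n+m (p j) _)
    ... | false = m≤m+n _ 0

  load-removeBundle-≢ : ∀ z {i i′} β → i′ ≢ i → load (removeBundle z i β) i′ ≡ load z i′
  load-removeBundle-≢ z {i} {i′} β i′≢i rewrite dec-false (i′ ≟ i) i′≢i = refl

  load-addBundle-≢ : ∀ z {i i′} β → i′ ≢ i → load (addBundle z i β) i′ ≡ load z i′
  load-addBundle-≢ z {i} {i′} β i′≢i rewrite dec-false (i′ ≟ i) i′≢i = refl

  bigLoad-update-≤ : ∀ z z′ {i d e} → IsBig i → (∀ i′ → i′ ≢ i → load z′ i′ ≡ load z i′) →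
                     load z′ i + d ≤ load z i + e → bigLoad z′ + d ≤ bigLoad z + e
  bigLoad-update-≤ z z′ {i} {d} {e} big agree ≤atᵢ =
    ∑-update-≤ i (λ i′ i′≢i → cong (λ l → if big? i′ then l else 0) (agree i′ i′≢i))
      (subst₂ (λ l l′ → l + d ≤ l′ + e) (sym (onBig-big (load z′) big)) (sym (onBig-big (load z) big))
              ≤atᵢ)

  bundleStep-potential : ∀ {s s′} → BundleStep s s′ → potential s′ ≤ potential s
  bundleStep-potential (remove {z} {bs} i _ β big _ _ β⊆row) = begin
    bigLoad z′ + (weight β + totalWeight bs)  ≡⟨ +-assoc (bigLoad z′) _ _ ⟨
    bigLoad z′ + weight β + totalWeight bs    ≤⟨ +-monoˡ-≤ (totalWeight bs) removal ⟩
    bigLoad z + 0 + totalWeight bs            ≡⟨ cong (_+ totalWeight bs) (+-identityʳ (bigLoad z)) ⟩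
    bigLoad z + totalWeight bs                ∎
    where
    open ≤-Reasoning
    z′ = removeBundle z i β
    removal : bigLoad z′ + weight β ≤ bigLoad z + 0
    removal = bigLoad-update-≤ z z′ big (λ _ → load-removeBundle-≢ z β)
      (≤-reflexive (trans (load-removeBundle z i β (proj₁ ∘₂ β⊆row)) (sym (+-identityʳ _))))

  placeStep-potential : ∀ {s s′} → PlaceStep s s′ → potential s′ ≤ potential s
  placeStep-potential (place {z} pre post β i big _) = begin
    bigLoad z′ + totalWeight (pre ++ post)              ≡⟨ cong (_+ totalWeight (pre ++ post)) (+-identityʳ _) ⟨
    bigLoad z′ + 0 + totalWeight (pre ++ post)          ≤⟨ +-monoˡ-≤ _ placement ⟩
    bigLoad z + weight β + totalWeight (pre ++ post)    ≡⟨ +-assoc (bigLoad z) _ _ ⟩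
    bigLoad z + (weight β + totalWeight (pre ++ post))  ≡⟨ cong (bigLoad z +_) (totalWeight-middle pre β post) ⟨
    bigLoad z + totalWeight (pre ++ β ∷ post)           ∎
    where
    open ≤-Reasoning
    z′ = addBundle z i β
    placement : bigLoad z′ + 0 ≤ bigLoad z + weight β
    placement = bigLoad-update-≤ z z′ big (λ _ → load-addBundle-≢ z β)
      (≤-trans (≤-reflexive (+-identityʳ _)) (load-addBundle z i β))

  bundleStep-sizes : ∀ {s s′} → BundleStep s s′ → BundlesOfSize s → BundlesOfSize s′
  bundleStep-sizes (remove _ _ _ _ _ ∣β∣≡a _) sizes = ∣β∣≡a ∷ sizes

  placeStep-sizes : ∀ {s s′} → PlaceStep s s′ → BundlesOfSize s → BundlesOfSize s′
  placeStep-sizes (place pre _ _ _ _ _) sizes with ++⁻ pre sizes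
  ... | pre-sizes , _ ∷ post-sizes = ++⁺ pre-sizes post-sizes

  ∑-load : ∀ x → (∀ j → ∑ (λ i → x i j) ≡ 1) → ∑ (load x) ≡ ∑ p
  ∑-load x column = begin
    ∑ (λ i → ∑ (λ j → p j * x i j))  ≡⟨ ∑-comm (λ i j → p j * x i j) ⟩
    ∑ (λ j → ∑ (λ i → p j * x i j))  ≡⟨ ∑-cong (λ j → *-distribˡ-∑ (p j) (λ i → x i j)) ⟨
    ∑ (λ j → p j * ∑ (λ i → x i j))  ≡⟨ ∑-cong (λ j → cong (p j *_) (column j)) ⟩
    ∑ (λ j → p j * 1)                ≡⟨ ∑-cong (λ j → *-identityʳ (p j)) ⟩
    ∑ p                              ∎
    where open ≡-Reasoning

  bigLoad-feasible : ∀ x → ∑ p ≡ ∑ T → ModIPFeasible x → bigLoad x ≡ bigTarget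
  bigLoad-feasible x ∑p≡∑T (_ , small-exact , _ , _ , column) =
    +-cancelʳ-≡ (∑ (onSmall T)) _ _ (begin
    bigLoad x + ∑ (onSmall T)          ≡⟨ cong (bigLoad x +_) (∑-cong onSmall-exact) ⟨
    bigLoad x + ∑ (onSmall (load x))   ≡⟨ ∑-onBig-onSmall (load x) ⟨
    ∑ (load x)                         ≡⟨ ∑-load x column ⟩
    ∑ p                                ≡⟨ ∑p≡∑T ⟩
    ∑ T                                ≡⟨ ∑-onBig-onSmall T ⟩
    bigTarget + ∑ (onSmall T)          ∎)
    where
    open ≡-Reasoning
    onSmall-exact : ∀ i → onSmall (load x) i ≡ onSmall T i
    onSmall-exact i with big? i | big?-reflects i
    ... | true  | _        = refl
    ... | false | ofⁿ ¬big = small-exact i (≰⇒> ¬big)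

  load-removeA : ∀ x {i} → IsBig i → load (removeA x) i + a * countOn x i a ≡ load x i
  load-removeA x {i} big =
    trans (cong (load (removeA x) i +_) (*-distribˡ-∑ a aJob))
          (trans (sym (∑-distrib-+ (λ j → p j * removeA x i j) (λ j → a * aJob j))) (∑-cong entry))
    where
    aJob : Fin n → ℕ
    aJob j = if p j ≡ᵇ a then x i j else 0
    entry : ∀ j → p j * removeA x i j + a * aJob j ≡ p j * x i j
    entry j with big? i | big?-true big | p j ≡ᵇ a | ≡ᵇ⇒≡ (p j) a
    ... | _ | refl | true  | pⱼ≡a rewrite pⱼ≡a _ = cong (_+ a * x i j) (*-zeroʳ a)
    ... | _ | refl | false | _    = trans (cong (p j * x i j +_) (*-zeroʳ a)) (+-identityʳ _)

  aJobsOnBig : Assignment → ℕ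
  aJobsOnBig x = ∑ (onBig (λ i → countOn x i a))

  bigLoad-removeA : ∀ x → bigLoad (removeA x) + a * aJobsOnBig x ≡ bigLoad x
  bigLoad-removeA x =
    trans (cong (bigLoad (removeA x) +_) (*-distribˡ-∑ a (onBig aJobs)))
          (trans (sym (∑-distrib-+ (onBig (load (removeA x))) (λ i → a * onBig aJobs i))) (∑-cong entry))
    where
    aJobs : Fin m → ℕ
    aJobs i = countOn x i a
    entry : ∀ i → onBig (load (removeA x)) i + a * onBig aJobs i ≡ onBig (load x) i
    entry i with pmax ^ 4 ≤? T i
    ... | yes big = begin
      onBig (load (removeA x)) i + a * onBig aJobs i
        ≡⟨ cong₂ _+_ (onBig-big (load (removeA x)) big) (cong (a *_) (onBig-big aJobs big)) ⟩
      load (removeA x) i + a * aJobs i                ≡⟨ load-removeA x big ⟩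
      load x i                                        ≡⟨ onBig-big (load x) big ⟨
      onBig (load x) i                                ∎
      where open ≡-Reasoning
    ... | no ¬big = begin
      onBig (load (removeA x)) i + a * onBig aJobs i
        ≡⟨ cong₂ _+_ (onBig-small (load (removeA x)) ¬big) (cong (a *_) (onBig-small aJobs ¬big)) ⟩
      0 + a * 0                                       ≡⟨ *-zeroʳ a ⟩
      0                                               ≡⟨ onBig-small (load x) ¬big ⟨
      onBig (load x) i                                ∎
      where open ≡-Reasoning

  aJobsOnBig-swap : ∀ x → ∑ (λ j → if p j ≡ᵇ a then ∑ (onBig (λ i → x i j)) else 0) ≡ aJobsOnBig x
  aJobsOnBig-swap x = begin
    ∑ (λ j → if p j ≡ᵇ a then ∑ (onBig (λ i → x i j)) else 0)
      ≡⟨ ∑-cong (λ j → if-∑ (p j ≡ᵇ a) (onBig (λ i → x i j))) ⟩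
    ∑ (λ j → ∑ (λ i → aJob j (onBig (λ i → x i j) i)))
      ≡⟨ ∑-comm (λ j i → aJob j (onBig (λ i → x i j) i)) ⟩
    ∑ (λ i → ∑ (λ j → aJob j (onBig (λ i → x i j) i)))
      ≡⟨ ∑-cong (λ i → ∑-cong λ j → if-comm (p j ≡ᵇ a) (big? i) (x i j)) ⟩
    ∑ (λ i → ∑ (λ j → onBig (λ i → aJob j (x i j)) i))
      ≡⟨ ∑-cong (λ i → if-∑ (big? i) (λ j → aJob j (x i j))) ⟨
    aJobsOnBig x
      ∎
    where
    open ≡-Reasoning
    aJob : Fin n → ℕ → ℕ
    aJob j v = if p j ≡ᵇ a then v else 0

  slack : ℕ
  slack = pmax ^ 2 * numBig

  initial-potential : ∀ x → ∑ p ≡ ∑ T → ModIPFeasible x → 1 ≤ a →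
                      potential (removeA x , []) + slack ≤ bigTarget
  initial-potential x ∑p≡∑T feasible@(_ , _ , _ , enough-aJobs , _) 1≤a = begin
    bigLoad (removeA x) + 0 + slack         ≡⟨ cong (_+ slack) (+-identityʳ _) ⟩
    bigLoad (removeA x) + slack             ≤⟨ +-monoʳ-≤ (bigLoad (removeA x)) slack≤ ⟩
    bigLoad (removeA x) + a * aJobsOnBig x  ≡⟨ bigLoad-removeA x ⟩
    bigLoad x                               ≡⟨ bigLoad-feasible x ∑p≡∑T feasible ⟩
    bigTarget                               ∎
    where
    open ≤-Reasoning
    slack≤ : slack ≤ a * aJobsOnBig x
    slack≤ = ≤-trans (≤-trans enough-aJobs (≤-reflexive (aJobsOnBig-swap x)))
                     (≤-trans (≤-reflexive (sym (*-identityˡ _))) (*-monoˡ-≤ (aJobsOnBig x) 1≤a))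

  ∑-onBig-+ : ∀ f g → ∑ (onBig (λ i → f i + g i)) ≡ ∑ (onBig f) + ∑ (onBig g)
  ∑-onBig-+ f g = trans (∑-cong λ i → if-distrib-+ (big? i) (f i) (g i)) (∑-distrib-+ (onBig f) (onBig g))

  ∑-onBig-const : ∀ c → ∑ (onBig (λ _ → c)) ≡ c * numBig
  ∑-onBig-const c = begin
    ∑ (onBig (λ _ → c))              ≡⟨ ∑-cong (λ i → cong (λ v → if big? i then v else 0) (*-identityʳ c)) ⟨
    ∑ (onBig (λ _ → c * 1))          ≡⟨ ∑-cong (λ i → *-distribˡ-if c (big? i) 1) ⟨
    ∑ (λ i → c * onBig (λ _ → 1) i)  ≡⟨ *-distribˡ-∑ c (onBig (λ _ → 1)) ⟨
    c * numBig                       ∎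
    where open ≡-Reasoning

  onBig-<⇒ : ∀ f g {i} → onBig f i < onBig g i → IsBig i × f i < g i
  onBig-<⇒ f g {i} fᵢ<gᵢ with pmax ^ 4 ≤? T i
  ... | yes big = big , subst₂ _<_ (onBig-big f big) (onBig-big g big) fᵢ<gᵢ
  ... | no ¬big = ⊥-elim (<-irrefl refl (subst₂ _<_ (onBig-small f ¬big) (onBig-small g ¬big) fᵢ<gᵢ))

  big-machine-with-room : ∀ z → ∃ IsBig → bigLoad z + slack ≤ bigTarget →
                          ∃ λ i → IsBig i × load z i + pmax ^ 2 ≤ T i
  big-machine-with-room z (i₀ , big₀) fits with ∑-<⇒∃-< ∑loaded<∑target
    where
    1≤numBig : 1 ≤ numBig
    1≤numBig = subst (_≤ numBig) (onBig-big (λ _ → 1) big₀) (≤-∑ (onBig (λ _ → 1)) i₀)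
    -- Comparing with 1 + T i makes the averaging strict; this is where B ≠ ∅ is used.
    ∑loaded<∑target : ∑ (onBig (λ i → load z i + pmax ^ 2)) < ∑ (onBig (λ i → 1 + T i))
    ∑loaded<∑target = begin-strict
      ∑ (onBig (λ i → load z i + pmax ^ 2))  ≡⟨ ∑-onBig-+ (load z) _ ⟩
      bigLoad z + ∑ (onBig (λ _ → pmax ^ 2))  ≡⟨ cong (bigLoad z +_) (∑-onBig-const (pmax ^ 2)) ⟩
      bigLoad z + slack                      ≤⟨ fits ⟩
      bigTarget                              <⟨ m<n+m bigTarget 1≤numBig ⟩
      numBig + bigTarget                     ≡⟨ ∑-onBig-+ (λ _ → 1) T ⟨
      ∑ (onBig (λ i → 1 + T i))              ∎
      where open ≤-Reasoning
  ... | i , loaded<target =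
    i , Product.map₂ s≤s⁻¹ (onBig-<⇒ (λ i → load z i + pmax ^ 2) (λ i → 1 + T i) loaded<target)

  weight-≤ : ∀ β → ∣ β ∣ ≡ a → a ≤ pmax → weight β ≤ pmax ^ 2
  weight-≤ β ∣β∣≡a a≤pmax = begin
    weight β      ≤⟨ ∑-selected-≤ β p ⟩
    ∣ β ∣ * pmax  ≡⟨ cong (_* pmax) ∣β∣≡a ⟩
    a * pmax      ≤⟨ *-monoˡ-≤ pmax a≤pmax ⟩
    pmax * pmax   ≡⟨ cong (pmax *_) (*-identityʳ pmax) ⟨
    pmax ^ 2      ∎
    where open ≤-Reasoning

  addBundle-fits : ∀ z {i} β → load z i + pmax ^ 2 ≤ T i → ∣ β ∣ ≡ a → a ≤ pmax →
                   load (addBundle z i β) i ≤ T i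
  addBundle-fits z {i} β room ∣β∣≡a a≤pmax =
    ≤-trans (load-addBundle z i β) (≤-trans (+-monoʳ-≤ (load z i) (weight-≤ β ∣β∣≡a a≤pmax)) room)

lemma1 : ∀ {n m : ℕ} (p : Fin n → ℕ) (T : Fin m → ℕ) →
    m ≥ 1 → n ≥ m → ∑ p ≡ ∑ T →
    (a : ℕ) → ∃ (λ j → p j ≡ a) →
    (x : Fin m → Fin n → ℕ) → Procedure.ModIPFeasible p T a x →
    ∃ (λ i → Procedure.IsBig p T a i) →
    (zI : Fin m → Fin n → ℕ) (bs : List (Subset n)) →
    Procedure.PhaseIResult p T a x (zI , bs) →
    (z : Fin m → Fin n → ℕ) (R : List (Subset n)) →
    Star (Procedure.PlaceStep p T a) (zI , bs) (z , R) →
    ∃ (λ i → Procedure.IsBig p T a i ×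
             Procedure.load p T a z i + Procedure.pmax p T a ^ 2 ≤ T i ×
             (∀ β → β ∈ R → Procedure.load p T a (Procedure.addBundle p T a z i β) i ≤ T i))
lemma1 p T _ _ ∑p≡∑T a (j₀ , pⱼ₀≡a) x feasible (i₀ , big₀) _ _ (phaseI , phaseI-end) z R phaseII =
  let i , big , room = big-machine-with-room z (i₀ , big₀) fits
  in  i , big , room , λ β β∈R → addBundle-fits z β room (All.lookup sizes β∈R) a≤pmax
  where
  open Procedure p T a
  open PotentialBound p T a
  -- Phase I ended, so a big machine holds fewer than a jobs of time a + 1.
  1≤a : 1 ≤ a
  1≤a = ≤-trans (s≤s z≤n) (phaseI-end i₀ (suc a) big₀ 1+n≢n)
  a≤pmax : a ≤ pmax
  a≤pmax = subst (_≤ pmax) pⱼ₀≡a (≤-maxᶠ p j₀)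
  potential-decreases : potential (z , R) ≤ potential (removeA x , [])
  potential-decreases = ≤-trans (Star-antitone potential placeStep-potential phaseII)
                                (Star-antitone potential bundleStep-potential phaseI)
  sizes : BundlesOfSize (z , R)
  sizes = Star-preserves placeStep-sizes phaseII (Star-preserves bundleStep-sizes phaseI [])
  fits : bigLoad z + slack ≤ bigTarget
  fits = ≤-trans (+-monoˡ-≤ slack (≤-trans (m≤m+n (bigLoad z) (totalWeight R)) potential-decreases))
                 (initial-potential x ∑p≡∑T feasible 1≤a)
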